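{- Let $G$ be a graph with $n$ vertices and $m\ge 1$ edges. Then $$M_{1}(G)\geq \frac{4m^{2}}{n}+\frac{Irr(G)^{2}}{mn}.$$
   Context: All graphs are finite, simple and undirected; $\deg(v)$ denotes the degree of a vertex $v$. The first Zagreb index is $M_1(G)=\sum_{v\in V(G)}\deg(v)^2$. The Albertson irregularity index is $Irr(G)=\sum_{(u,v)\in E(G)}|\deg(u)-\deg(v)|$, the sum running over edges. -}

module Defs where

open import Data.Bool using (Bool; true; false; if_then_else_)
open import Data.Nat using (ℕ; zero; suc; _+_; _*_; _<_; NonZero; ∣_-_∣)
open import Data.Fin using (Fin; toℕ)
open import Data.List using (List; map)
open import Data.Nat.ListAction using (sum)
open import Data.List using (allFin)
open import Data.Nat.Properties using (_<?_)
open import Relation.Binary.PropositionalEquality using (_≡_)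

record Graph (n : ℕ) : Set where
  field
    adj   : Fin n → Fin n → Bool
    sym   : ∀ i j → adj i j ≡ adj j i
    irrefl : ∀ i → adj i i ≡ false
open Graph public

Σv : ∀ {n} → (Fin n → ℕ) → ℕ
Σv {n} f = sum (map f (allFin n))

ind : Bool → ℕ
ind true  = 1
ind false = 0

deg : ∀ {n} → Graph n → Fin n → ℕ
deg G i = Σv (λ j → ind (adj G i j))

-- Sum of f(u,v) over the edges {u,v}, each unordered edge counted once
-- (as the pair u < v).
Σe : ∀ {n} → Graph n → (Fin n → Fin n → ℕ) → ℕ
Σe G f = Σv (λ i → Σv (λ j → if adj G i j then (if toℕ i Data.Nat.<ᵇ toℕ j then f i j else 0) else 0))

edgeCount : ∀ {n} → Graph n → ℕ
edgeCount G = Σe G (λ _ _ → 1)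

M1 : ∀ {n} → Graph n → ℕ
M1 G = Σv (λ v → deg G v * deg G v)

Irr : ∀ {n} → Graph n → ℕ
Irr G = Σe G (λ u v → ∣ deg G u - deg G v ∣)

vertices-nonzero : ∀ {n} (G : Graph n) → .{{NonZero (edgeCount G)}} → NonZero n
vertices-nonzero {zero}  G {{()}}
vertices-nonzero {suc n} G = _

{-# OPTIONS --safe #-}
module Submission where

-- The Lagrange identity n·Σ d_v² − (Σ d_v)² = ½ Σ_{u,v} (d_u − d_v)², whose right-hand side is at
-- least the sum of (d_u − d_v)² over the edges alone, together with the handshake lemma Σ d_v = 2m,
-- gives n·M₁ ≥ 4m² + Σ_{uv∈E} (d_u − d_v)²; Cauchy–Schwarz over the m edges bounds that last sum
-- below by Irr²/m. All of this is done over ℕ in the cross-multiplied form 4m³ + Irr² ≤ m·n·M₁.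

module CauchySchwarz where

  open import Data.Nat
  open import Data.Nat.Properties
  open import Data.Fin using (Fin)
  open import Data.Product using (_×_; _,_)
  open import Data.Sum using (inj₁; inj₂)
  open import Relation.Binary.PropositionalEquality
  open import Data.Nat.Tactic.RingSolver
  open import Algebra.Properties.Semiring.Sum +-*-semiring
    using (sum; sum-cong-≗; ∑-distrib-+; *-distribˡ-sum)

  ∣m-n∣²+2mn≡m²+n²-ordered : ∀ {m n} → m ≤ n →
    ∣ m - n ∣ * ∣ m - n ∣ + 2 * (m * n) ≡ m * m + n * n
  ∣m-n∣²+2mn≡m²+n²-ordered {m} m≤n with m≤n⇒∃[o]m+o≡n m≤n
  ... | k , refl rewrite ∣m-m+n∣≡n m k = identity m k
    where
    identity : ∀ m k → k * k + 2 * (m * (m + k)) ≡ m * m + (m + k) * (m + k)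
    identity = solve-∀

  ∣m-n∣²+2mn≡m²+n² : ∀ m n → ∣ m - n ∣ * ∣ m - n ∣ + 2 * (m * n) ≡ m * m + n * n
  ∣m-n∣²+2mn≡m²+n² m n with ≤-total m n
  ... | inj₁ m≤n = ∣m-n∣²+2mn≡m²+n²-ordered m≤n
  ... | inj₂ n≤m rewrite ∣-∣-comm m n | *-comm m n | +-comm (m * m) (n * n) =
    ∣m-n∣²+2mn≡m²+n²-ordered n≤m

  -- Abstracted so that one Cauchy–Schwarz serves sums over vertices and over pairs of vertices.
  record Summation (I : Set) : Set where
    field
      Sum            : (I → ℕ) → ℕ
      Sum-cong       : ∀ {f g} → f ≗ g → Sum f ≡ Sum g
      Sum-distrib-+  : ∀ f g → Sum (λ i → f i + g i) ≡ Sum f + Sum g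
      *-distribˡ-Sum : ∀ c f → c * Sum f ≡ Sum (λ i → c * f i)

    *-distribʳ-Sum : ∀ c f → Sum f * c ≡ Sum (λ i → f i * c)
    *-distribʳ-Sum c f = trans (*-comm (Sum f) c)
      (trans (*-distribˡ-Sum c f) (Sum-cong (λ i → *-comm c (f i))))

  finSummation : ∀ n → Summation (Fin n)
  finSummation n = record
    { Sum            = sum
    ; Sum-cong       = sum-cong-≗
    ; Sum-distrib-+  = ∑-distrib-+
    ; *-distribˡ-Sum = *-distribˡ-sum
    }

  pairSummation : ∀ {I J} → Summation I → Summation J → Summation (I × J)
  pairSummation A B = record
    { Sum            = λ f → A.Sum (λ i → B.Sum (λ j → f (i , j)))
    ; Sum-cong       = λ f≗g → A.Sum-cong (λ i → B.Sum-cong (λ j → f≗g (i , j)))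
    ; Sum-distrib-+  = λ f g → trans (A.Sum-cong (λ i → B.Sum-distrib-+ _ _)) (A.Sum-distrib-+ _ _)
    ; *-distribˡ-Sum = λ c f → trans (A.*-distribˡ-Sum c _) (A.Sum-cong (λ i → B.*-distribˡ-Sum c _))
    }
    where module A = Summation A
          module B = Summation B

  module _ {I : Set} (Σ : Summation I) where
    open Summation Σ
    open Summation (pairSummation Σ Σ) using ()
      renaming (Sum to Sum²; Sum-cong to Sum²-cong; Sum-distrib-+ to Sum²-distrib-+)

    Sum*Sum : ∀ f g → Sum f * Sum g ≡ Sum² (λ (k , l) → f k * g l)
    Sum*Sum f g = trans (*-distribʳ-Sum (Sum g) f) (Sum-cong (λ k → *-distribˡ-Sum (f k) g))

    lagrange-identity : ∀ (w b : I → ℕ) →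
      2 * (Sum w * Sum (λ k → w k * (b k * b k))) ≡
      2 * (Sum (λ k → w k * b k) * Sum (λ k → w k * b k)) +
      Sum² (λ (k , l) → w k * w l * (∣ b k - b l ∣ * ∣ b k - b l ∣))
    lagrange-identity w b = begin
        2 * (W * Q)
      ≡⟨ 2[xy]≡xy+yx W Q ⟩
        W * Q + Q * W
      ≡⟨ cong₂ _+_ (Sum*Sum w wb²) (Sum*Sum wb² w) ⟩
        Sum² (λ (k , l) → w k * wb² l) + Sum² (λ (k , l) → wb² k * w l)
      ≡⟨ sym (Sum²-distrib-+ _ _) ⟩
        Sum² (λ (k , l) → w k * wb² l + wb² k * w l)
      ≡⟨ Sum²-cong (λ (k , l) → pointwise (w k) (w l) (b k) (b l)) ⟩
        Sum² (λ (k , l) → wb k * wb l + wb k * wb l + w k * w l * (∣ b k - b l ∣ * ∣ b k - b l ∣))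
      ≡⟨ Sum²-distrib-+ _ _ ⟩
        Sum² (λ (k , l) → wb k * wb l + wb k * wb l) + D
      ≡⟨ cong (_+ D) (Sum²-distrib-+ _ _) ⟩
        Sum² (λ (k , l) → wb k * wb l) + Sum² (λ (k , l) → wb k * wb l) + D
      ≡⟨ cong (λ x → x + x + D) (sym (Sum*Sum wb wb)) ⟩
        P * P + P * P + D
      ≡⟨ cong (_+ D) (x+x≡2x (P * P)) ⟩
        2 * (P * P) + D
      ∎
      where
      open ≡-Reasoning
      wb wb² : I → ℕ
      wb k = w k * b k
      wb² k = w k * (b k * b k)
      W = Sum w
      Q = Sum wb²
      P = Sum wb
      D = Sum² (λ (k , l) → w k * w l * (∣ b k - b l ∣ * ∣ b k - b l ∣))
      2[xy]≡xy+yx : ∀ x y → 2 * (x * y) ≡ x * y + y * x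
      2[xy]≡xy+yx = solve-∀
      x+x≡2x : ∀ x → x + x ≡ 2 * x
      x+x≡2x = solve-∀
      pointwise : ∀ u v x y →
        u * (v * (y * y)) + u * (x * x) * v ≡
        u * x * (v * y) + u * x * (v * y) + u * v * (∣ x - y ∣ * ∣ x - y ∣)
      pointwise u v x y = begin
          u * (v * (y * y)) + u * (x * x) * v
        ≡⟨ regroup u v x y ⟩
          u * v * (x * x + y * y)
        ≡⟨ cong (u * v *_) (sym (∣m-n∣²+2mn≡m²+n² x y)) ⟩
          u * v * (∣ x - y ∣ * ∣ x - y ∣ + 2 * (x * y))
        ≡⟨ expand u v x y (∣ x - y ∣ * ∣ x - y ∣) ⟩
          u * x * (v * y) + u * x * (v * y) + u * v * (∣ x - y ∣ * ∣ x - y ∣)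
        ∎
        where
        regroup : ∀ u v x y → u * (v * (y * y)) + u * (x * x) * v ≡ u * v * (x * x + y * y)
        regroup = solve-∀
        expand : ∀ u v x y s → u * v * (s + 2 * (x * y)) ≡ u * x * (v * y) + u * x * (v * y) + u * v * s
        expand = solve-∀

    cauchy-schwarz : ∀ (w b : I → ℕ) →
      Sum (λ k → w k * b k) * Sum (λ k → w k * b k) ≤ Sum w * Sum (λ k → w k * (b k * b k))
    cauchy-schwarz w b = *-cancelˡ-≤ 2 (begin
        2 * (P * P)                                           ≤⟨ m≤m+n _ _ ⟩
        2 * (P * P) + Sum² (λ (k , l) → w k * w l * (∣ b k - b l ∣ * ∣ b k - b l ∣))
                                                              ≡⟨ sym (lagrange-identity w b) ⟩
        2 * (Sum w * Sum (λ k → w k * (b k * b k)))            ∎)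
      where
      open ≤-Reasoning
      P = Sum (λ k → w k * b k)


module DegreeSums where

  open import Data.Nat
  open import Data.Nat.Properties
  open import Data.Bool using (Bool; true; false; if_then_else_)
  open import Data.Bool.Properties using (if-swap-then)
  open import Data.Fin using (Fin; zero; suc; toℕ)
  open import Data.Fin.Properties using (toℕ-injective)
  open import Data.Product using (_×_; _,_)
  open import Data.Empty using (⊥-elim)
  open import Data.List using (tabulate)
  open import Data.List.Properties using (map-tabulate)
  import Data.Nat.ListAction as List
  open import Relation.Nullary.Reflects using (ofʸ; ofⁿ)
  open import Relation.Binary.PropositionalEquality
  open import Data.Nat.Tactic.RingSolver
  open import Algebra.Properties.Semiring.Sum +-*-semiring
    using (sum; sum-syntax; sum-cong-≗; ∑-distrib-+; ∑-comm)
  open import Algebra.Properties.CommutativeSemigroup *-commutativeSemigroup using (x∙yz≈y∙xz)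
  open import Defs hiding (sym)
  open Defs using () renaming (sym to adj-sym)
  open CauchySchwarz

  ∑-mono-≤ : ∀ {n} {f g : Fin n → ℕ} → (∀ i → f i ≤ g i) → sum f ≤ sum g
  ∑-mono-≤ {zero}  f≤g = z≤n
  ∑-mono-≤ {suc n} f≤g = +-mono-≤ (f≤g zero) (∑-mono-≤ (λ i → f≤g (suc i)))

  ∑∑-cong : ∀ {n} {f g : Fin n → Fin n → ℕ} → (∀ i j → f i j ≡ g i j) →
    ∑[ i < n ] ∑[ j < n ] f i j ≡ ∑[ i < n ] ∑[ j < n ] g i j
  ∑∑-cong {n} f≡g = sum-cong-≗ {n} (λ i → sum-cong-≗ {n} (f≡g i))

  ∑-const-1 : ∀ n → ∑[ i < n ] 1 ≡ n
  ∑-const-1 zero    = refl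
  ∑-const-1 (suc n) = cong suc (∑-const-1 n)

  sum-tabulate : ∀ n (f : Fin n → ℕ) → List.sum (tabulate f) ≡ sum f
  sum-tabulate zero    f = refl
  sum-tabulate (suc n) f = cong (f zero +_) (sum-tabulate n (λ i → f (suc i)))

  Σv≡∑ : ∀ {n} (f : Fin n → ℕ) → Σv f ≡ sum f
  Σv≡∑ {n} f = trans (cong List.sum (map-tabulate (λ i → i) f)) (sum-tabulate n f)

  lagrange-identity-Fin : ∀ n (b : Fin n → ℕ) →
    2 * (n * ∑[ k < n ] (b k * b k)) ≡
    2 * (sum b * sum b) + ∑[ k < n ] ∑[ l < n ] (∣ b k - b l ∣ * ∣ b k - b l ∣)
  lagrange-identity-Fin n b = begin
      2 * (n * ∑[ k < n ] (b k * b k))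
    ≡⟨ cong₂ (λ x y → 2 * (x * y)) (sym (∑-const-1 n))
             (sum-cong-≗ {n} (λ k → sym (*-identityˡ _))) ⟩
      2 * (∑[ k < n ] 1 * ∑[ k < n ] (1 * (b k * b k)))
    ≡⟨ lagrange-identity (finSummation n) (λ _ → 1) b ⟩
      2 * (∑[ k < n ] (1 * b k) * ∑[ k < n ] (1 * b k)) +
      ∑[ k < n ] ∑[ l < n ] (1 * 1 * (∣ b k - b l ∣ * ∣ b k - b l ∣))
    ≡⟨ cong₂ (λ x y → 2 * (x * x) + y) (sum-cong-≗ {n} (λ k → *-identityˡ _))
             (∑∑-cong {n} (λ k l → *-identityˡ _)) ⟩
      2 * (sum b * sum b) + ∑[ k < n ] ∑[ l < n ] (∣ b k - b l ∣ * ∣ b k - b l ∣)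
    ∎
    where open ≡-Reasoning

  _<ᶠ_ : ∀ {n} → Fin n → Fin n → Bool
  i <ᶠ j = toℕ i <ᵇ toℕ j

  split-at-diagonal : ∀ {n} (h : Fin n → Fin n → ℕ) (i j : Fin n) → (i ≡ j → h i j ≡ 0) →
    h i j ≡ (if i <ᶠ j then h i j else 0) + (if j <ᶠ i then h i j else 0)
  split-at-diagonal h i j diagonal
    with i <ᶠ j | <ᵇ-reflects-< (toℕ i) (toℕ j) | j <ᶠ i | <ᵇ-reflects-< (toℕ j) (toℕ i)
  ... | true  | ofʸ i<j | true  | ofʸ j<i = ⊥-elim (<-asym i<j j<i)
  ... | true  | _       | false | _       = sym (+-identityʳ _)
  ... | false | _       | true  | _       = refl
  ... | false | ofⁿ i≮j | false | ofⁿ j≮i = diagonal (toℕ-injective (≤-antisym (≮⇒≥ j≮i) (≮⇒≥ i≮j)))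

  ∑∑-symmetric : ∀ {n} (h : Fin n → Fin n → ℕ) →
    (∀ i j → h i j ≡ h j i) → (∀ i → h i i ≡ 0) →
    ∑[ i < n ] ∑[ j < n ] h i j ≡ 2 * ∑[ i < n ] ∑[ j < n ] (if i <ᶠ j then h i j else 0)
  ∑∑-symmetric {n} h symmetric diagonal = begin
      ∑[ i < n ] ∑[ j < n ] h i j
    ≡⟨ ∑∑-cong (λ i j → split-at-diagonal h i j (λ { refl → diagonal i })) ⟩
      ∑[ i < n ] ∑[ j < n ] (upper i j + (if j <ᶠ i then h i j else 0))
    ≡⟨ ∑∑-cong (λ i j → cong (λ x → upper i j + (if j <ᶠ i then x else 0)) (symmetric i j)) ⟩
      ∑[ i < n ] ∑[ j < n ] (upper i j + upper j i)
    ≡⟨ trans (sum-cong-≗ {n} (λ i → ∑-distrib-+ (upper i) (λ j → upper j i)))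
             (∑-distrib-+ {n} _ _) ⟩
      U + ∑[ i < n ] ∑[ j < n ] upper j i
    ≡⟨ cong (U +_) (∑-comm (λ i j → upper j i)) ⟩
      U + U
    ≡⟨ cong (U +_) (sym (+-identityʳ U)) ⟩
      2 * U
    ∎
    where
    open ≡-Reasoning
    upper : Fin n → Fin n → ℕ
    upper i j = if i <ᶠ j then h i j else 0
    U = ∑[ i < n ] ∑[ j < n ] upper i j

  if-then-1*x : ∀ (a b : Bool) x →
    (if a then (if b then 1 else 0) else 0) * x ≡ (if a then (if b then x else 0) else 0)
  if-then-1*x true  true  x = +-identityʳ x
  if-then-1*x true  false x = refl
  if-then-1*x false b     x = refl

  ind≡if : ∀ b → ind b ≡ (if b then 1 else 0)
  ind≡if true  = refl
  ind≡if false = refl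

  if-then-x≤x : ∀ (b : Bool) x → (if b then x else 0) ≤ x
  if-then-x≤x true  x = ≤-refl
  if-then-x≤x false x = z≤n

  module _ {n} (G : Graph n) where

    Σe≡∑∑ : ∀ f →
      Σe G f ≡ ∑[ i < n ] ∑[ j < n ] (if adj G i j then (if i <ᶠ j then f i j else 0) else 0)
    Σe≡∑∑ f = trans (Σv≡∑ {n} _) (sum-cong-≗ {n} (λ i → Σv≡∑ {n} _))

    ∑∑-adj≡2Σe : ∀ f → (∀ i j → f i j ≡ f j i) →
      ∑[ i < n ] ∑[ j < n ] (if adj G i j then f i j else 0) ≡ 2 * Σe G f
    ∑∑-adj≡2Σe f f-symmetric = begin
        ∑[ i < n ] ∑[ j < n ] h i j
      ≡⟨ ∑∑-symmetric h h-symmetric h-diagonal ⟩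
        2 * ∑[ i < n ] ∑[ j < n ] (if i <ᶠ j then h i j else 0)
      ≡⟨ cong (2 *_) (∑∑-cong (λ i j → if-swap-then (i <ᶠ j) (adj G i j))) ⟩
        2 * ∑[ i < n ] ∑[ j < n ] (if adj G i j then (if i <ᶠ j then f i j else 0) else 0)
      ≡⟨ cong (2 *_) (sym (Σe≡∑∑ f)) ⟩
        2 * Σe G f
      ∎
      where
      open ≡-Reasoning
      h : Fin n → Fin n → ℕ
      h i j = if adj G i j then f i j else 0
      h-symmetric : ∀ i j → h i j ≡ h j i
      h-symmetric i j rewrite adj-sym G i j | f-symmetric i j = refl
      h-diagonal : ∀ i → h i i ≡ 0
      h-diagonal i rewrite irrefl G i = refl

    handshake : sum (deg G) ≡ 2 * edgeCount G
    handshake = begin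
        sum (deg G)
      ≡⟨ sum-cong-≗ {n} (λ i → Σv≡∑ {n} _) ⟩
        ∑[ i < n ] ∑[ j < n ] ind (adj G i j)
      ≡⟨ ∑∑-cong (λ i j → ind≡if (adj G i j)) ⟩
        ∑[ i < n ] ∑[ j < n ] (if adj G i j then 1 else 0)
      ≡⟨ ∑∑-adj≡2Σe (λ _ _ → 1) (λ _ _ → refl) ⟩
        2 * edgeCount G
      ∎
      where open ≡-Reasoning

    2Σe≤∑∑ : ∀ f → (∀ i j → f i j ≡ f j i) →
      2 * Σe G f ≤ ∑[ i < n ] ∑[ j < n ] f i j
    2Σe≤∑∑ f f-symmetric = subst (_≤ _) (∑∑-adj≡2Σe f f-symmetric)
      (∑-mono-≤ (λ i → ∑-mono-≤ (λ j → if-then-x≤x (adj G i j) (f i j))))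

    Σe-cauchy-schwarz : ∀ f → Σe G f * Σe G f ≤ edgeCount G * Σe G (λ i j → f i j * f i j)
    Σe-cauchy-schwarz f = subst₂ _≤_ (cong₂ _*_ (Σe-weighted f) (Σe-weighted f))
      (cong₂ _*_ (sym (Σe≡∑∑ (λ _ _ → 1))) (Σe-weighted (λ i j → f i j * f i j)))
      (cauchy-schwarz (pairSummation (finSummation n) (finSummation n)) edge (λ (i , j) → f i j))
      where
      edge : Fin n × Fin n → ℕ
      edge (i , j) = if adj G i j then (if i <ᶠ j then 1 else 0) else 0
      Σe-weighted : ∀ g → ∑[ i < n ] ∑[ j < n ] (edge (i , j) * g i j) ≡ Σe G g
      Σe-weighted g =
        trans (∑∑-cong (λ i j → if-then-1*x (adj G i j) (i <ᶠ j) (g i j))) (sym (Σe≡∑∑ g))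

    edge-irregularity-bound :
      4 * edgeCount G * edgeCount G * edgeCount G + Irr G * Irr G ≤ edgeCount G * n * M1 G
    edge-irregularity-bound = *-cancelˡ-≤ 2 (begin
        2 * (4 * m * m * m + Irr G * Irr G)
      ≡⟨ expand m (Irr G * Irr G) ⟩
        8 * (m * m * m) + 2 * (Irr G * Irr G)
      ≤⟨ +-monoʳ-≤ (8 * (m * m * m)) (*-monoʳ-≤ 2 (Σe-cauchy-schwarz gap)) ⟩
        8 * (m * m * m) + 2 * (m * Σe G gap²)
      ≡⟨ cong (8 * (m * m * m) +_) (x∙yz≈y∙xz 2 m (Σe G gap²)) ⟩
        8 * (m * m * m) + m * (2 * Σe G gap²)
      ≤⟨ +-monoʳ-≤ (8 * (m * m * m)) (*-monoʳ-≤ m (2Σe≤∑∑ gap² gap²-symmetric)) ⟩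
        8 * (m * m * m) + m * D
      ≡⟨ factor m D ⟩
        m * (2 * ((2 * m) * (2 * m)) + D)
      ≡⟨ cong (λ s → m * (2 * (s * s) + D)) (sym handshake) ⟩
        m * (2 * (sum (deg G) * sum (deg G)) + D)
      ≡⟨ cong (m *_) (sym (lagrange-identity-Fin n (deg G))) ⟩
        m * (2 * (n * ∑[ k < n ] (deg G k * deg G k)))
      ≡⟨ cong (λ s → m * (2 * (n * s))) (sym (Σv≡∑ {n} _)) ⟩
        m * (2 * (n * M1 G))
      ≡⟨ x∙yz≈y∙xz m 2 (n * M1 G) ⟩
        2 * (m * (n * M1 G))
      ≡⟨ cong (2 *_) (sym (*-assoc m n (M1 G))) ⟩
        2 * (m * n * M1 G)
      ∎)
      where
      open ≤-Reasoning
      m = edgeCount G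
      gap gap² : Fin n → Fin n → ℕ
      gap i j = ∣ deg G i - deg G j ∣
      gap² i j = gap i j * gap i j
      gap²-symmetric : ∀ i j → gap² i j ≡ gap² j i
      gap²-symmetric i j = cong₂ _*_ (∣-∣-comm (deg G i) _) (∣-∣-comm (deg G i) _)
      D = ∑[ i < n ] ∑[ j < n ] gap² i j
      expand : ∀ m x → 2 * (4 * m * m * m + x) ≡ 8 * (m * m * m) + 2 * x
      expand = solve-∀
      factor : ∀ m x → 8 * (m * m * m) + m * x ≡ m * (2 * ((2 * m) * (2 * m)) + x)
      factor = solve-∀

module Fractions where

  open import Data.Nat as ℕ using (ℕ; suc; NonZero)
  open import Data.Integer as ℤ using (+_)
  import Data.Integer.Properties as ℤ
  open import Data.Rational using (_/_; _+_; _≤_; toℚᵘ)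
  open import Data.Rational.Properties using (toℚᵘ-fromℚᵘ; toℚᵘ-cancel-≤; toℚᵘ-homo-+)
  open import Data.Rational.Unnormalised as ℚᵘ using (mkℚᵘ; *≤*)
  import Data.Rational.Unnormalised.Properties as ℚᵘ
  open import Relation.Binary.PropositionalEquality

  toℚᵘ-/ : ∀ i d .{{_ : NonZero d}} → toℚᵘ (i / d) ℚᵘ.≃ i ℚᵘ./ d
  toℚᵘ-/ i (suc d) = toℚᵘ-fromℚᵘ (mkℚᵘ i d)

  /ᵘ+/ᵘ≤/ᵘ1 : ∀ a b c n k .{{_ : NonZero n}} .{{_ : NonZero k}} →
    a ℕ.* k ℕ.+ b ℕ.* n ℕ.≤ c ℕ.* (n ℕ.* k) →
    (+ a) ℚᵘ./ n ℚᵘ.+ (+ b) ℚᵘ./ k ℚᵘ.≤ (+ c) ℚᵘ./ 1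
  /ᵘ+/ᵘ≤/ᵘ1 a b c (suc n) (suc k) cross =
    *≤* (subst₂ ℤ._≤_ lhs (ℤ.pos-* c (suc n ℕ.* suc k)) (ℤ.+≤+ cross))
    where
    lhs : + (a ℕ.* suc k ℕ.+ b ℕ.* suc n) ≡ (+ a ℤ.* + suc k ℤ.+ + b ℤ.* + suc n) ℤ.* + 1
    lhs = trans (ℤ.pos-+ (a ℕ.* suc k) _)
          (trans (cong₂ ℤ._+_ (ℤ.pos-* a (suc k)) (ℤ.pos-* b (suc n)))
                 (sym (ℤ.*-identityʳ _)))

  /+/≤/1 : ∀ a b c n k .{{_ : NonZero n}} .{{_ : NonZero k}} →
    a ℕ.* k ℕ.+ b ℕ.* n ℕ.≤ c ℕ.* (n ℕ.* k) →
    (+ a) / n + (+ b) / k ≤ (+ c) / 1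
  /+/≤/1 a b c n k cross = toℚᵘ-cancel-≤ (begin
    toℚᵘ ((+ a) / n + (+ b) / k)          ≃⟨ toℚᵘ-homo-+ ((+ a) / n) ((+ b) / k) ⟩
    toℚᵘ ((+ a) / n) ℚᵘ.+ toℚᵘ ((+ b) / k) ≃⟨ ℚᵘ.+-cong (toℚᵘ-/ (+ a) n) (toℚᵘ-/ (+ b) k) ⟩
    (+ a) ℚᵘ./ n ℚᵘ.+ (+ b) ℚᵘ./ k         ≤⟨ /ᵘ+/ᵘ≤/ᵘ1 a b c n k cross ⟩
    (+ c) ℚᵘ./ 1                          ≃⟨ toℚᵘ-/ (+ c) 1 ⟨
    toℚᵘ ((+ c) / 1)                      ∎)
    where open ℚᵘ.≤-Reasoning

open import Defs
open import Data.Nat using (ℕ; NonZero; _*_)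
open import Data.Nat.Properties using (m*n≢0; *-monoʳ-≤)
open import Data.Integer using (+_)
open import Data.Rational using (_/_; _+_; _≤_)
import Data.Nat as ℕ
open import Relation.Binary.PropositionalEquality using (_≡_; subst₂)
open import Data.Nat.Tactic.RingSolver using (solve-∀)
open DegreeSums using (edge-irregularity-bound)
open Fractions using (/+/≤/1)

corollary2p3 : ∀ (n : ℕ) (G : Graph n) → .{{_ : NonZero (edgeCount G)}} →
  let m = edgeCount G
      instance nz-n : NonZero n
               nz-n = vertices-nonzero G
      instance nz-mn : NonZero (m * n)
               nz-mn = m*n≢0 m n
  in ((+ (4 * m * m)) / n) + ((+ (Irr G * Irr G)) / (m * n)) ≤ ((+ M1 G) / 1)
corollary2p3 n G {{m≢0}} =
  /+/≤/1 (4 * m * m) (Irr G * Irr G) (M1 G) n (m * n) {{n≢0}} {{m*n≢0 m n {{m≢0}} {{n≢0}}}}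
    (subst₂ ℕ._≤_ (cross-left m n (Irr G * Irr G)) (cross-right m n (M1 G))
      (*-monoʳ-≤ n (edge-irregularity-bound G)))
  where
  m = edgeCount G
  n≢0 = vertices-nonzero G {{m≢0}}
  cross-left : ∀ m n x → n * (4 * m * m * m ℕ.+ x) ≡ 4 * m * m * (m * n) ℕ.+ x * n
  cross-left = solve-∀
  cross-right : ∀ m n x → n * (m * n * x) ≡ x * (n * (m * n))
  cross-right = solve-∀
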